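{- Let $W=\langle r_1,r_2\mid r_1^2=r_2^2=1\rangle$ be the infinite dihedral group (the affine Coxeter group of type $\widetilde A_1$, with $m_{12}=\infty$). Then its Cayley graph with respect to $\{r_1,r_2\}$ satisfies the strong hull property: for all $u,v,w\in W$, $|\mathrm{Conv}(u,v)|\cdot|\mathrm{Conv}(v,w)|\ge|\mathrm{Conv}(u,v,w)|$.
   Context: The Cayley graph has vertex set $W$, with $u,v$ adjacent iff $u^{ -1}v\in\{r_1,r_2\}$; $d$ is the shortest-path distance. A vertex set $C$ is convex if $u,v\in C$ and $d(u,w)+d(w,v)=d(u,v)$ imply $w\in C$. $\mathrm{Conv}(X)$ is the smallest convex set containing $X$. The strong hull property is the stated inequality holding for all triples of vertices. -}

module Defs where

open import Data.Nat using (ℕ; zero; suc; _+_; _*_; _≤_)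
open import Data.Bool using (Bool; true; false)
open import Data.Product using (Σ; _×_; _,_)
open import Data.Sum using (_⊎_)
open import Data.List using (List; length)
open import Data.List.Membership.Propositional using (_∈_)
open import Data.List.Relation.Unary.Unique.Propositional using (Unique)
open import Function.Bundles using (_⇔_)
open import Relation.Binary.PropositionalEquality using (_≡_)

data Gen : Set where
  r₁ r₂ : Gen

other : Gen → Gen
other r₁ = r₂
other r₂ = r₁

sameGen : Gen → Gen → Bool
sameGen r₁ r₁ = true
sameGen r₂ r₂ = true
sameGen r₁ r₂ = false
sameGen r₂ r₁ = false

-- Elements of W = ⟨ r₁ , r₂ ∣ r₁² = r₂² = 1 ⟩ (m₁₂ = ∞) in reduced-word
-- normal form: ε is the identity, and  alt g k  is the alternating reduced
-- word of length (suc k) starting with g:  g (other g) g (other g) ...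
-- Every element of W is represented by exactly one such reduced word.
data W : Set where
  ε   : W
  alt : Gen → ℕ → W

lastLetter : Gen → ℕ → Gen
lastLetter g zero    = g
lastLetter g (suc k) = other (lastLetter g k)

shorten : Gen → ℕ → W
shorten g zero    = ε
shorten g (suc k) = alt g k

mulGen' : Gen → ℕ → Gen → Bool → W
mulGen' g k r true  = shorten g k
mulGen' g k r false = alt g (suc k)

_·_ : W → Gen → W
ε       · r = alt r zero
alt g k · r = mulGen' g k r (sameGen (lastLetter g k) r)

Adj : W → W → Set
Adj u v = Σ Gen (λ r → v ≡ u · r)

data Walk : W → W → ℕ → Set where
  here : ∀ {u} → Walk u u zero
  step : ∀ {u v w n} → Adj u v → Walk v w n → Walk u w (suc n)

Dist : W → W → ℕ → Set
Dist u v n = Walk u v n × (∀ m → Walk u v m → n ≤ m)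

Subset : Set₁
Subset = W → Set

Convex : Subset → Set
Convex C = ∀ u v w a b c → C u → C v →
           Dist u w a → Dist w v b → Dist u v c → a + b ≡ c → C w

Conv : Subset → W → Set₁
Conv X w = (C : Subset) → Convex C → (∀ x → X x → C x) → C w

HasCard : (W → Set₁) → ℕ → Set₁
HasCard P n = Σ (List W) (λ L → Unique L × length L ≡ n × (∀ x → (x ∈ L) ⇔ P x))

pair : W → W → Subset
pair u v x = x ≡ u ⊎ x ≡ v

triple : W → W → W → Subset
triple u v w x = x ≡ u ⊎ x ≡ v ⊎ x ≡ w

StrongHull : Set₁
StrongHull = ∀ u v w → Σ ℕ λ a → Σ ℕ λ b → Σ ℕ λ c →
  HasCard (Conv (pair u v)) a × HasCard (Conv (pair v w)) b ×
  HasCard (Conv (triple u v w)) c × c ≤ a * b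

-- Reading the reduced word  alt r₁ k  as k + 1 and  alt r₂ k  as −(k + 1)
-- identifies W with ℤ in such a way that right multiplication by r₁ and by r₂
-- moves one step in opposite directions.  So the Cayley graph is the path
-- graph on ℤ and d(u,v) = |u − v|.  A geodesic from x to y only visits points
-- between x and y, hence the convex sets are the intervals and Conv X is the
-- interval spanned by the extreme points a, b of X, with d(a,b) + 1 elements.
-- The diameter of {u,v,w} is at most d(u,v) + d(v,w), and
-- 1 + m + n ≤ (1 + m)(1 + n).
module Submission where

open import Defs
open import Data.Integer as ℤ using (ℤ; +_; -[1+_]; +[1+_]; ∣_∣; pred; 0ℤ; 1ℤ; -1ℤ; +≤+)
  renaming (suc to sucℤ)
import Data.Integer.Properties as ℤₚ
open import Algebra.Properties.AbelianGroup ℤₚ.+-0-abelianGroup using (∙-cancelˡ)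
open import Data.Integer.Tactic.RingSolver using (solve-∀)
open import Data.List using (map; upTo)
open import Data.List.Membership.Propositional using (_∈_)
import Data.List.Membership.Propositional.Properties as ∈ₚ
import Data.List.Properties as Listₚ
import Data.List.Relation.Unary.Unique.Propositional.Properties as Uniqueₚ
open import Data.Nat using (ℕ; zero; suc; _+_; _*_; _≤_; z≤n; s≤s)
import Data.Nat.Properties as ℕₚ
import Data.Nat.Tactic.RingSolver as ℕSolver
open import Data.Product using (Σ; _×_; _,_; proj₁; proj₂)
open import Data.Sum as Sum using (_⊎_; inj₁; inj₂)
open import Function using (_∘_)
open import Function.Bundles using (mk⇔)
open import Relation.Binary.PropositionalEquality

-- W ≅ ℤ

toℤ : W → ℤ
toℤ ε          = 0ℤ
toℤ (alt r₁ k) = +[1+ k ]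
toℤ (alt r₂ k) = -[1+ k ]

fromℤ : ℤ → W
fromℤ (+ zero)  = ε
fromℤ +[1+ k ] = alt r₁ k
fromℤ -[1+ k ] = alt r₂ k

fromℤ-toℤ : ∀ u → fromℤ (toℤ u) ≡ u
fromℤ-toℤ ε          = refl
fromℤ-toℤ (alt r₁ k) = refl
fromℤ-toℤ (alt r₂ k) = refl

toℤ-fromℤ : ∀ i → toℤ (fromℤ i) ≡ i
toℤ-fromℤ (+ zero)  = refl
toℤ-fromℤ +[1+ k ] = refl
toℤ-fromℤ -[1+ k ] = refl

toℤ-injective : ∀ {u v} → toℤ u ≡ toℤ v → u ≡ v
toℤ-injective {u} {v} eq = begin
  u              ≡⟨ fromℤ-toℤ u ⟨
  fromℤ (toℤ u)  ≡⟨ cong fromℤ eq ⟩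
  fromℤ (toℤ v)  ≡⟨ fromℤ-toℤ v ⟩
  v              ∎
  where open ≡-Reasoning

·-steps : ∀ u → (toℤ (u · r₁) ≡ sucℤ (toℤ u) × toℤ (u · r₂) ≡ pred (toℤ u))
              ⊎ (toℤ (u · r₁) ≡ pred (toℤ u) × toℤ (u · r₂) ≡ sucℤ (toℤ u))
·-steps ε = inj₁ (refl , refl)
·-steps (alt g k) with lastLetter g k
·-steps (alt r₁ zero)    | r₁ = inj₂ (refl , refl)
·-steps (alt r₁ (suc k)) | r₁ = inj₂ (refl , refl)
·-steps (alt r₁ zero)    | r₂ = inj₁ (refl , refl)
·-steps (alt r₁ (suc k)) | r₂ = inj₁ (refl , refl)
·-steps (alt r₂ zero)    | r₁ = inj₁ (refl , refl)
·-steps (alt r₂ (suc k)) | r₁ = inj₁ (refl , refl)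
·-steps (alt r₂ zero)    | r₂ = inj₂ (refl , refl)
·-steps (alt r₂ (suc k)) | r₂ = inj₂ (refl , refl)

·-suc : ∀ u → Σ Gen λ r → toℤ (u · r) ≡ sucℤ (toℤ u)
·-suc u with ·-steps u
... | inj₁ (up , _) = r₁ , up
... | inj₂ (_ , up) = r₂ , up

·-pred : ∀ u → Σ Gen λ r → toℤ (u · r) ≡ pred (toℤ u)
·-pred u with ·-steps u
... | inj₁ (_ , down) = r₂ , down
... | inj₂ (down , _) = r₁ , down

·-suc-or-pred : ∀ u r → toℤ (u · r) ≡ sucℤ (toℤ u) ⊎ toℤ (u · r) ≡ pred (toℤ u)
·-suc-or-pred u r₁ = Sum.map proj₁ proj₁ (·-steps u)
·-suc-or-pred u r₂ = Sum.swap (Sum.map proj₂ proj₂ (·-steps u))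

Between : ℤ → ℤ → ℤ → Set
Between i j k = ∣ i ℤ.- j ∣ + ∣ j ℤ.- k ∣ ≡ ∣ i ℤ.- k ∣

∣i-k∣≤∣i-j∣+∣j-k∣ : ∀ i j k → ∣ i ℤ.- k ∣ ≤ ∣ i ℤ.- j ∣ + ∣ j ℤ.- k ∣
∣i-k∣≤∣i-j∣+∣j-k∣ i j k =
  subst (λ x → ∣ x ∣ ≤ ∣ i ℤ.- j ∣ + ∣ j ℤ.- k ∣) (ℤₚ.+-minus-telescope i j k)
        (ℤₚ.∣i+j∣≤∣i∣+∣j∣ (i ℤ.- j) (j ℤ.- k))

i≤j⇒i+∣i-j∣≡j : ∀ {i j} → i ℤ.≤ j → i ℤ.+ + ∣ i ℤ.- j ∣ ≡ j
i≤j⇒i+∣i-j∣≡j {i} {j} i≤j = trans (cong (ℤ._+_ i) (ℤₚ.∣-∣-≤ i≤j)) (i+[j-i]≡j i j)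
  where
  i+[j-i]≡j : ∀ i j → i ℤ.+ (j ℤ.- i) ≡ j
  i+[j-i]≡j = solve-∀

≤-between : ∀ {i j k} → i ℤ.≤ j → j ℤ.≤ k → Between i j k
≤-between {i} {j} {k} i≤j j≤k = ℤₚ.+-injective (begin
  + (∣ i ℤ.- j ∣ + ∣ j ℤ.- k ∣)    ≡⟨ ℤₚ.pos-+ ∣ i ℤ.- j ∣ ∣ j ℤ.- k ∣ ⟩
  + ∣ i ℤ.- j ∣ ℤ.+ + ∣ j ℤ.- k ∣  ≡⟨ cong₂ ℤ._+_ (ℤₚ.∣-∣-≤ i≤j) (ℤₚ.∣-∣-≤ j≤k) ⟩
  (j ℤ.- i) ℤ.+ (k ℤ.- j)          ≡⟨ ℤₚ.+-comm (j ℤ.- i) (k ℤ.- j) ⟩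
  (k ℤ.- j) ℤ.+ (j ℤ.- i)          ≡⟨ ℤₚ.+-minus-telescope k j i ⟩
  k ℤ.- i                          ≡⟨ ℤₚ.∣-∣-≤ (ℤₚ.≤-trans i≤j j≤k) ⟨
  + ∣ i ℤ.- k ∣                    ∎)
  where open ≡-Reasoning

between-sym : ∀ {i j k} → Between i j k → Between k j i
between-sym {i} {j} {k} ijk = begin
  ∣ k ℤ.- j ∣ + ∣ j ℤ.- i ∣  ≡⟨ cong₂ _+_ (ℤₚ.∣i-j∣≡∣j-i∣ k j) (ℤₚ.∣i-j∣≡∣j-i∣ j i) ⟩
  ∣ j ℤ.- k ∣ + ∣ i ℤ.- j ∣  ≡⟨ ℕₚ.+-comm ∣ j ℤ.- k ∣ ∣ i ℤ.- j ∣ ⟩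
  ∣ i ℤ.- j ∣ + ∣ j ℤ.- k ∣  ≡⟨ ijk ⟩
  ∣ i ℤ.- k ∣                ≡⟨ ℤₚ.∣i-j∣≡∣j-i∣ i k ⟩
  ∣ k ℤ.- i ∣                ∎
  where open ≡-Reasoning

≥-between : ∀ {i j k} → k ℤ.≤ j → j ℤ.≤ i → Between i j k
≥-between {i} {j} {k} k≤j j≤i = between-sym {k} {j} {i} (≤-between k≤j j≤i)

m+n+[n+o]≤m+o⇒n≡0 : ∀ m n o → m + n + (n + o) ≤ m + o → n ≡ 0
m+n+[n+o]≤m+o⇒n≡0 m n o le =
  ℕₚ.m+n≡0⇒m≡0 n (ℕₚ.n≤0⇒n≡0 (ℕₚ.+-cancelˡ-≤ (m + o) (n + n) 0 (begin
    m + o + (n + n)  ≡⟨ rearrange m n o ⟩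
    m + n + (n + o)  ≤⟨ le ⟩
    m + o            ≡⟨ ℕₚ.+-identityʳ (m + o) ⟨
    m + o + 0        ∎)))
  where
  open ℕₚ.≤-Reasoning
  rearrange : ∀ m n o → m + o + (n + n) ≡ m + n + (n + o)
  rearrange = ℕSolver.solve-∀

-- Going from i to k through j and through c on both sides of j costs 2|c − j|
-- more than going from i to k through c.
between-squeeze : ∀ {i j k c} → Between i j k → Between i c j → Between j c k → j ≡ c
between-squeeze {i} {j} {k} {c} ijk icj jck =
  sym (ℤₚ.i-j≡0⇒i≡j c j (ℤₚ.∣i∣≡0⇒i≡0
    (m+n+[n+o]≤m+o⇒n≡0 (∣ i ℤ.- c ∣) (∣ c ℤ.- j ∣) (∣ c ℤ.- k ∣) (begin
    ∣ i ℤ.- c ∣ + ∣ c ℤ.- j ∣ + (∣ c ℤ.- j ∣ + ∣ c ℤ.- k ∣)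
      ≡⟨ cong₂ _+_ icj (trans (cong (_+ ∣ c ℤ.- k ∣) (ℤₚ.∣i-j∣≡∣j-i∣ c j)) jck) ⟩
    ∣ i ℤ.- j ∣ + ∣ j ℤ.- k ∣  ≡⟨ ijk ⟩
    ∣ i ℤ.- k ∣                ≤⟨ ∣i-k∣≤∣i-j∣+∣j-k∣ i c k ⟩
    ∣ i ℤ.- c ∣ + ∣ c ℤ.- k ∣  ∎))))
  where open ℕₚ.≤-Reasoning

between-lower-bound : ∀ {lo i j k} → lo ℤ.≤ i → lo ℤ.≤ k → Between i j k → lo ℤ.≤ j
between-lower-bound {lo} {i} {j} {k} lo≤i lo≤k ijk with ℤₚ.≤-total lo j
... | inj₁ lo≤j = lo≤j
... | inj₂ j≤lo =
  ℤₚ.≤-reflexive (sym (between-squeeze {i} {j} {k} ijk (≥-between j≤lo lo≤i) (≤-between j≤lo lo≤k)))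

between-upper-bound : ∀ {hi i j k} → i ℤ.≤ hi → k ℤ.≤ hi → Between i j k → j ℤ.≤ hi
between-upper-bound {hi} {i} {j} {k} i≤hi k≤hi ijk with ℤₚ.≤-total j hi
... | inj₁ j≤hi = j≤hi
... | inj₂ hi≤j =
  ℤₚ.≤-reflexive (between-squeeze {i} {j} {k} ijk (≤-between i≤hi hi≤j) (≥-between k≤hi hi≤j))

d : W → W → ℕ
d u v = ∣ toℤ u ℤ.- toℤ v ∣

d-sym : ∀ u v → d u v ≡ d v u
d-sym u v = ℤₚ.∣i-j∣≡∣j-i∣ (toℤ u) (toℤ v)

d-self : ∀ u → d u u ≡ 0
d-self u = cong ∣_∣ (ℤₚ.+-inverseʳ (toℤ u))

d-triangle : ∀ u v w → d u w ≤ d u v + d v w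
d-triangle u v w = ∣i-k∣≤∣i-j∣+∣j-k∣ (toℤ u) (toℤ v) (toℤ w)

d-· : ∀ u r → d u (u · r) ≡ 1
d-· u r with ·-suc-or-pred u r
... | inj₁ up   = trans (cong (λ j → ∣ toℤ u ℤ.- j ∣) up) (cong ∣_∣ (i-[1+i]≡-1 (toℤ u)))
  where
  i-[1+i]≡-1 : ∀ i → i ℤ.- (1ℤ ℤ.+ i) ≡ -1ℤ
  i-[1+i]≡-1 = solve-∀
... | inj₂ down = trans (cong (λ j → ∣ toℤ u ℤ.- j ∣) down) (cong ∣_∣ (i-[-1+i]≡1 (toℤ u)))
  where
  i-[-1+i]≡1 : ∀ i → i ℤ.- (-1ℤ ℤ.+ i) ≡ 1ℤ
  i-[-1+i]≡1 = solve-∀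

d≤walk-length : ∀ {u v n} → Walk u v n → d u v ≤ n
d≤walk-length {u} here = ℕₚ.≤-reflexive (d-self u)
d≤walk-length {u} {v} {suc n} (step (r , refl) walk) = begin
  d u v                      ≤⟨ d-triangle u (u · r) v ⟩
  d u (u · r) + d (u · r) v  ≡⟨ cong (_+ d (u · r) v) (d-· u r) ⟩
  suc (d (u · r) v)          ≤⟨ s≤s (d≤walk-length walk) ⟩
  suc n                      ∎
  where open ℕₚ.≤-Reasoning

walk-zero : ∀ {u v} → toℤ u ≡ toℤ v → Walk u v 0
walk-zero {u} eq = subst (λ v → Walk u v 0) (toℤ-injective eq) here

walk-up : ∀ k u v → toℤ u ℤ.+ + k ≡ toℤ v → Walk u v k
walk-up zero    u v eq = walk-zero (trans (sym (ℤₚ.+-identityʳ (toℤ u))) eq)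
walk-up (suc k) u v eq with ·-suc u
... | r , up = step (r , refl) (walk-up k (u · r) v (begin
  toℤ (u · r) ℤ.+ + k   ≡⟨ cong (ℤ._+ + k) up ⟩
  sucℤ (toℤ u) ℤ.+ + k  ≡⟨ [1+i]+j≡i+[1+j] (toℤ u) (+ k) ⟩
  toℤ u ℤ.+ + suc k     ≡⟨ eq ⟩
  toℤ v                 ∎))
  where
  open ≡-Reasoning
  [1+i]+j≡i+[1+j] : ∀ i j → (1ℤ ℤ.+ i) ℤ.+ j ≡ i ℤ.+ (1ℤ ℤ.+ j)
  [1+i]+j≡i+[1+j] = solve-∀

walk-down : ∀ k u v → toℤ v ℤ.+ + k ≡ toℤ u → Walk u v k
walk-down zero    u v eq = walk-zero (sym (trans (sym (ℤₚ.+-identityʳ (toℤ v))) eq))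
walk-down (suc k) u v eq with ·-pred u
... | r , down = step (r , refl) (walk-down k (u · r) v (begin
  toℤ v ℤ.+ + k             ≡⟨ i+j≡-1+[i+[1+j]] (toℤ v) (+ k) ⟩
  pred (toℤ v ℤ.+ + suc k)  ≡⟨ cong pred eq ⟩
  pred (toℤ u)              ≡⟨ down ⟨
  toℤ (u · r)               ∎))
  where
  open ≡-Reasoning
  i+j≡-1+[i+[1+j]] : ∀ i j → i ℤ.+ j ≡ -1ℤ ℤ.+ (i ℤ.+ (1ℤ ℤ.+ j))
  i+j≡-1+[i+[1+j]] = solve-∀

geodesic : ∀ u v → Walk u v (d u v)
geodesic u v with ℤₚ.≤-total (toℤ u) (toℤ v)
... | inj₁ u≤v = walk-up (d u v) u v (i≤j⇒i+∣i-j∣≡j u≤v)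
... | inj₂ v≤u = walk-down (d u v) u v
  (trans (cong (λ n → toℤ v ℤ.+ + n) (d-sym u v)) (i≤j⇒i+∣i-j∣≡j v≤u))

dist : ∀ u v → Dist u v (d u v)
dist u v = geodesic u v , λ _ → d≤walk-length

Dist⇒≡d : ∀ {u v n} → Dist u v n → n ≡ d u v
Dist⇒≡d {u} {v} (walk , minimal) = ℕₚ.≤-antisym (minimal _ (geodesic u v)) (d≤walk-length walk)

geodesic-between : ∀ {u v w a b c} → Dist u w a → Dist w v b → Dist u v c → a + b ≡ c →
                   Between (toℤ u) (toℤ w) (toℤ v)
geodesic-between uw wv uv a+b≡c =
  trans (sym (cong₂ _+_ (Dist⇒≡d uw) (Dist⇒≡d wv))) (trans a+b≡c (Dist⇒≡d uv))

-- Convex hulls are intervals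

Interval : ℤ → ℤ → Subset
Interval lo hi w = lo ℤ.≤ toℤ w × toℤ w ℤ.≤ hi

Interval-convex : ∀ lo hi → Convex (Interval lo hi)
Interval-convex lo hi u v w _ _ _ (lo≤u , u≤hi) (lo≤v , v≤hi) uw wv uv a+b≡c =
  between-lower-bound lo≤u lo≤v uwv , between-upper-bound u≤hi v≤hi uwv
  where uwv = geodesic-between uw wv uv a+b≡c

Extremes : Subset → W → W → Set
Extremes X a b = X a × X b × (∀ x → X x → Interval (toℤ a) (toℤ b) x)

Conv⊆Interval : ∀ {X a b} → Extremes X a b → ∀ w → Conv X w → Interval (toℤ a) (toℤ b) w
Conv⊆Interval (_ , _ , X⊆I) w w∈ConvX = w∈ConvX _ (Interval-convex _ _) X⊆I

Interval⊆Conv : ∀ {X a b} → X a → X b → ∀ w → Interval (toℤ a) (toℤ b) w → Conv X w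
Interval⊆Conv {a = a} {b} Xa Xb w (a≤w , w≤b) C C-convex X⊆C =
  C-convex a b w _ _ _ (X⊆C a Xa) (X⊆C b Xb) (dist a w) (dist w b) (dist a b) (≤-between a≤w w≤b)

Interval-card : ∀ {lo hi} {P : W → Set₁} → lo ℤ.≤ hi →
                (∀ w → P w → Interval lo hi w) → (∀ w → Interval lo hi w → P w) →
                HasCard P (suc ∣ lo ℤ.- hi ∣)
Interval-card {lo} {hi} lo≤hi P⊆I I⊆P =
  elements ,
  Uniqueₚ.map⁺ shift-injective (Uniqueₚ.upTo⁺ (suc k)) ,
  trans (Listₚ.length-map shift (upTo (suc k))) (Listₚ.length-upTo (suc k)) ,
  λ w → mk⇔ (I⊆P w ∘ ∈⇒Interval) (Interval⇒∈ ∘ P⊆I w)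
  where
  k = ∣ lo ℤ.- hi ∣

  shift : ℕ → W
  shift m = fromℤ (lo ℤ.+ + m)

  elements = map shift (upTo (suc k))

  toℤ-shift : ∀ m → toℤ (shift m) ≡ lo ℤ.+ + m
  toℤ-shift m = toℤ-fromℤ (lo ℤ.+ + m)

  shift-injective : ∀ {m n} → shift m ≡ shift n → m ≡ n
  shift-injective {m} {n} eq = ℤₚ.+-injective
    (∙-cancelˡ lo (+ m) (+ n) (trans (sym (toℤ-shift m)) (trans (cong toℤ eq) (toℤ-shift n))))

  ∈⇒Interval : ∀ {w} → w ∈ elements → Interval lo hi w
  ∈⇒Interval w∈ with ∈ₚ.∈-map⁻ shift w∈
  ... | m , m∈ , refl = subst (λ i → lo ℤ.≤ i × i ℤ.≤ hi) (sym (toℤ-shift m))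
    (ℤₚ.i≤i+j lo (+ m) ,
     ℤₚ.≤-trans (ℤₚ.+-monoʳ-≤ lo (+≤+ (ℕₚ.≤-pred (∈ₚ.∈-upTo⁻ m∈))))
                (ℤₚ.≤-reflexive (i≤j⇒i+∣i-j∣≡j lo≤hi)))

  Interval⇒∈ : ∀ {w} → Interval lo hi w → w ∈ elements
  Interval⇒∈ {w} (lo≤w , w≤hi) =
    subst (_∈ elements) shift-offset (∈ₚ.∈-map⁺ shift (∈ₚ.∈-upTo⁺ (s≤s offset≤k)))
    where
    offset = ∣ lo ℤ.- toℤ w ∣
    shift-offset : shift offset ≡ w
    shift-offset = trans (cong fromℤ (i≤j⇒i+∣i-j∣≡j lo≤w)) (fromℤ-toℤ w)
    offset≤k : offset ≤ k
    offset≤k = subst (offset ≤_) (≤-between lo≤w w≤hi) (ℕₚ.m≤m+n offset _)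

Conv-card : ∀ {X a b} → Extremes X a b → HasCard (Conv X) (suc (d a b))
Conv-card {a = a} E@(Xa , Xb , X⊆I) =
  Interval-card (proj₂ (X⊆I a Xa)) (Conv⊆Interval E) (Interval⊆Conv Xa Xb)

pair⊆Interval : ∀ {u v} → toℤ u ℤ.≤ toℤ v → ∀ x → pair u v x → Interval (toℤ u) (toℤ v) x
pair⊆Interval u≤v _ (inj₁ refl) = ℤₚ.≤-refl , u≤v
pair⊆Interval u≤v _ (inj₂ refl) = u≤v , ℤₚ.≤-refl

pair-extremes : ∀ u v → Σ W λ a → Σ W λ b → Extremes (pair u v) a b × d a b ≡ d u v
pair-extremes u v with ℤₚ.≤-total (toℤ u) (toℤ v)
... | inj₁ u≤v = u , v , (inj₁ refl , inj₂ refl , pair⊆Interval u≤v) , refl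
... | inj₂ v≤u =
  v , u , (inj₂ refl , inj₁ refl , λ x → pair⊆Interval v≤u x ∘ Sum.swap) , d-sym v u

Conv-pair-card : ∀ u v → HasCard (Conv (pair u v)) (suc (d u v))
Conv-pair-card u v with pair-extremes u v
... | _ , _ , E , dab≡duv = subst (HasCard (Conv (pair u v)) ∘ suc) dab≡duv (Conv-card E)

Extremes-insert : ∀ {X a b} u → Extremes X a b →
                  Σ W λ a′ → Σ W λ b′ → Extremes (λ x → x ≡ u ⊎ X x) a′ b′
Extremes-insert {a = a} {b} u (Xa , Xb , X⊆I) with ℤₚ.≤-total (toℤ u) (toℤ a)
... | inj₁ u≤a = u , b , inj₁ refl , inj₂ Xb , λ
  { _ (inj₁ refl) → ℤₚ.≤-refl , ℤₚ.≤-trans u≤a (proj₂ (X⊆I a Xa))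
  ; x (inj₂ Xx)   → ℤₚ.≤-trans u≤a (proj₁ (X⊆I x Xx)) , proj₂ (X⊆I x Xx) }
... | inj₂ a≤u with ℤₚ.≤-total (toℤ u) (toℤ b)
...   | inj₁ u≤b = a , b , inj₂ Xa , inj₂ Xb , λ
  { _ (inj₁ refl) → a≤u , u≤b
  ; x (inj₂ Xx)   → X⊆I x Xx }
...   | inj₂ b≤u = a , u , inj₂ Xa , inj₁ refl , λ
  { _ (inj₁ refl) → a≤u , ℤₚ.≤-refl
  ; x (inj₂ Xx)   → proj₁ (X⊆I x Xx) , ℤₚ.≤-trans (proj₂ (X⊆I x Xx)) b≤u }

triple-extremes : ∀ u v w → Σ W λ a → Σ W λ b → Extremes (triple u v w) a b
triple-extremes u v w with pair-extremes v w
... | _ , _ , E , _ = Extremes-insert u E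

triple-diameter : ∀ {u v w a b} → triple u v w a → triple u v w b → d a b ≤ d u v + d v w
triple-diameter {u} {v} {w} = diameter
  where
  zero≤ : ∀ x → d x x ≤ d u v + d v w
  zero≤ x = subst (_≤ _) (sym (d-self x)) z≤n

  flip : ∀ x y → d x y ≤ d u v + d v w → d y x ≤ d u v + d v w
  flip x y = subst (_≤ _) (d-sym x y)

  diameter : ∀ {a b} → triple u v w a → triple u v w b → d a b ≤ d u v + d v w
  diameter (inj₁ refl)        (inj₁ refl)        = zero≤ u
  diameter (inj₂ (inj₁ refl)) (inj₂ (inj₁ refl)) = zero≤ v
  diameter (inj₂ (inj₂ refl)) (inj₂ (inj₂ refl)) = zero≤ w
  diameter (inj₁ refl)        (inj₂ (inj₁ refl)) = ℕₚ.m≤m+n (d u v) (d v w)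
  diameter (inj₂ (inj₁ refl)) (inj₂ (inj₂ refl)) = ℕₚ.m≤n+m (d v w) (d u v)
  diameter (inj₁ refl)        (inj₂ (inj₂ refl)) = d-triangle u v w
  diameter (inj₂ (inj₁ refl)) (inj₁ refl)        = flip u v (ℕₚ.m≤m+n (d u v) (d v w))
  diameter (inj₂ (inj₂ refl)) (inj₂ (inj₁ refl)) = flip v w (ℕₚ.m≤n+m (d v w) (d u v))
  diameter (inj₂ (inj₂ refl)) (inj₁ refl)        = flip u w (d-triangle u v w)

m≤n+o⇒1+m≤[1+n]*[1+o] : ∀ {m} n o → m ≤ n + o → suc m ≤ suc n * suc o
m≤n+o⇒1+m≤[1+n]*[1+o] {m} n o m≤n+o = s≤s (begin
  m              ≤⟨ m≤n+o ⟩
  n + o          ≡⟨ ℕₚ.+-comm n o ⟩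
  o + n          ≤⟨ ℕₚ.+-monoʳ-≤ o (ℕₚ.m≤m*n n (suc o)) ⟩
  o + n * suc o  ∎)
  where open ℕₚ.≤-Reasoning

theorem2p6 : ∀ (u v w : W) → Σ ℕ λ a → Σ ℕ λ b → Σ ℕ λ c →
    HasCard (Conv (pair u v)) a × HasCard (Conv (pair v w)) b ×
    HasCard (Conv (triple u v w)) c × c ≤ a * b
theorem2p6 u v w with triple-extremes u v w
... | a , b , E@(a∈uvw , b∈uvw , _) =
  suc (d u v) , suc (d v w) , suc (d a b) ,
  Conv-pair-card u v , Conv-pair-card v w , Conv-card E ,
  m≤n+o⇒1+m≤[1+n]*[1+o] (d u v) (d v w) (triple-diameter a∈uvw b∈uvw)
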